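{- If $G$ is a finite connected graph with $\mathrm{diam}(G)\ge 3$ and $c_H(G)=c(G)+2$, then $G$ contains a triangle or a four-cycle (as a subgraph).
   Context: $c(G)$ is the usual cop number of $G$ (classical Cops and Robbers with the robber always visible). Hyperopic Cops and Robbers on a finite connected simple graph $G$: one player controls $k$ cops, the other a single robber. The cops first choose starting vertices (several cops may share a vertex), then the robber chooses a starting vertex; afterwards, in each round, each cop moves to an adjacent vertex or stays put, and then the robber moves to an adjacent vertex or stays put. The robber always knows the cops' positions. The robber is invisible to the cops exactly when the robber's vertex is adjacent to the vertex of every cop (a robber on the same vertex as a cop is visible); otherwise the cops see the robber's position. The cops win if after finitely many rounds some cop occupies the robber's vertex, and the cops' strategy must guarantee this with certainty (no chance allowed). The hyperopic cop number $c_H(G)$ is the minimum $k$ for which $k$ cops have a winning strategy. -}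

module Defs where

open import Data.Nat using (ℕ; zero; suc; _≤_; _<_)
open import Data.Fin using (Fin)
open import Data.Bool using (Bool; true; false; not; if_then_else_)
open import Data.Maybe using (Maybe; just; nothing)
open import Data.List using (List; []; _∷_; map; allFin)
open import Data.Bool.ListAction using (and)

open import Data.Product using (Σ; ∃; ∃-syntax; _×_; _,_; proj₁; proj₂)
open import Data.Sum using (_⊎_)
open import Relation.Nullary using (¬_)
open import Relation.Binary.PropositionalEquality using (_≡_; _≢_)

record Graph : Set where
  field
    n      : ℕ
    adj    : Fin n → Fin n → Bool
    sym    : ∀ u v → adj u v ≡ adj v u
    irrefl : ∀ v → adj v v ≡ false

module _ (G : Graph) where
  open Graph G

  V : Set
  V = Fin n

  Adj : V → V → Set
  Adj u v = adj u v ≡ true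

  data Walk : V → V → ℕ → Set where
    here  : ∀ {u} → Walk u u zero
    there : ∀ {u v w ℓ} → Adj u v → Walk v w ℓ → Walk u w (suc ℓ)

  Connected : Set
  Connected = ∀ (u v : V) → ∃[ ℓ ] Walk u v ℓ

  DiamAtLeast3 : Set
  DiamAtLeast3 = ∃[ u ] ∃[ v ] (∀ ℓ → Walk u v ℓ → 3 ≤ ℓ)

  HasTriangle : Set
  HasTriangle = ∃[ a ] ∃[ b ] ∃[ c ] (Adj a b × Adj b c × Adj c a)

  -- a four-cycle subgraph: four distinct vertices a,b,c,d with ab,bc,cd,da edges
  -- (a≠b, b≠c, c≠d, d≠a follow from irreflexivity)
  HasFourCycle : Set
  HasFourCycle = ∃[ a ] ∃[ b ] ∃[ c ] ∃[ d ]
    (a ≢ c × b ≢ d × Adj a b × Adj b c × Adj c d × Adj d a)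

  Config : ℕ → Set
  Config k = Fin k → V

  Move : V → V → Set
  Move u u' = u' ≡ u ⊎ Adj u u'

  CopStep : ∀ {k} → Config k → Config k → Set
  CopStep c c' = ∀ i → Move (c i) (c' i)

  -- what the cops observe: the robber's vertex, or nothing if invisible
  Obs : Set
  Obs = Maybe V

  Visibility : Set
  Visibility = ∀ {k} → Config k → V → Bool

  classicalVis : Visibility
  classicalVis _ _ = true

  hyperopicVis : Visibility
  hyperopicVis {k} c r = not (and (map (λ i → adj (c i) r) (allFin k)))

  record CopStrategy (k : ℕ) : Set where
    field
      start : Config k
      move  : (c : Config k) → List Obs → Σ (Config k) (CopStep c)

  module Play (vis : Visibility) {k : ℕ} (σ : CopStrategy k) (r : ℕ → V) where
    open CopStrategy σ

    observe : Config k → V → Obs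
    observe c x = if vis c x then just x else nothing

    -- state t = (cop configuration at round t, observation history so far,
    -- most recent first).  The history contains the observation of the robber
    -- at every intermediate position: after each cop move and each robber move.
    state : ℕ → Config k × List Obs
    state zero = start , (observe start (r zero) ∷ [])
    state (suc t) =
      let c  = proj₁ (state t)
          h  = proj₂ (state t)
          c' = proj₁ (move c h)
      in c' , (observe c' (r (suc t)) ∷ observe c' (r t) ∷ h)

    cops : ℕ → Config k
    cops t = proj₁ (state t)

    CaughtAt : ℕ → Set
    CaughtAt t = (∃[ i ] cops t i ≡ r t) ⊎ (∃[ i ] cops (suc t) i ≡ r t)

  -- legal robber plays (the starting vertex r 0 is arbitrary)
  RobberPlay : (ℕ → V) → Set
  RobberPlay r = ∀ t → Move (r t) (r (suc t))

  CopsWin : Visibility → ℕ → Set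
  CopsWin vis k = Σ (CopStrategy k) λ σ →
    ∀ (r : ℕ → V) → RobberPlay r → ∃[ t ] Play.CaughtAt vis σ r t

  IsMinWinning : Visibility → ℕ → Set
  IsMinWinning vis m = CopsWin vis m × (∀ j → j < m → ¬ CopsWin vis j)

  IsCopNumber : ℕ → Set
  IsCopNumber = IsMinWinning classicalVis

  IsHyperopicCopNumber : ℕ → Set
  IsHyperopicCopNumber = IsMinWinning hyperopicVis

-- In a graph without four-cycles two distinct vertices have at most one common
-- neighbour.  So if c cops win the classical game, c + 1 cops win the hyperopic
-- one: the extra cop escorts one of the others, always standing on a different
-- vertex, and an invisible robber is then the unique common neighbour of the two.
-- Hence c_H(G) ≤ c(G) + 1 for every C₄-free graph with at least two vertices.
module Submission where

open import Defs
open import Data.Nat using (ℕ; zero; suc; _+_; _<_)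
open import Data.Nat.Properties using (+-comm; n<1+n)
open import Data.Fin using (zero; suc; _≟_)
open import Data.Fin.Properties using (any?)
open import Data.Bool using (T; true; false; if_then_else_)
open import Data.Bool.ListAction using (all)
open import Data.Bool.Properties using (not-injective; T-≡) renaming (_≟_ to _≟ᵇ_)
open import Data.Maybe using (Maybe; just; nothing)
open import Data.List using (List; []; _∷_; allFin)
open import Data.List.Relation.Unary.All as All using ()
open import Data.List.Relation.Unary.All.Properties using (all⁺)
open import Data.List.Membership.Propositional.Properties using (∈-allFin)
open import Data.Vec.Functional as Vector using (tail)
open import Data.Product using (Σ; ∃-syntax; _×_; _,_; proj₁; proj₂)
open import Data.Sum using (_⊎_; inj₁; inj₂)
open import Data.Empty using (⊥-elim)
open import Function.Bundles using (Equivalence)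
open import Relation.Nullary using (¬_; Dec; yes; no)
open import Relation.Nullary.Decidable using (_×-dec_; ¬?)
open import Relation.Binary.PropositionalEquality
  using (_≡_; _≢_; refl; sym; trans; cong; cong₂; cong-app; subst)

module _ (G : Graph) where
  open Graph G using (adj)

  Adj? : ∀ u v → Dec (Adj G u v)
  Adj? u v = adj u v ≟ᵇ true

  Adj-sym : ∀ {u v} → Adj G u v → Adj G v u
  Adj-sym {u} {v} uv = trans (Graph.sym G v u) uv

  Move-sym : ∀ {u v} → Move G u v → Move G v u
  Move-sym (inj₁ v≡u) = inj₁ (sym v≡u)
  Move-sym (inj₂ uv)  = inj₂ (Adj-sym uv)

  hasFourCycle? : Dec (HasFourCycle G)
  hasFourCycle? = any? λ a → any? λ b → any? λ c → any? λ d →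
    ¬? (a ≟ c) ×-dec ¬? (b ≟ d) ×-dec
    Adj? a b ×-dec Adj? b c ×-dec Adj? c d ×-dec Adj? d a

  invisible⇒adjacentToAll : ∀ {k} (c : Config G k) x →
    hyperopicVis G c x ≡ false → ∀ i → Adj G (c i) x
  invisible⇒adjacentToAll {k} c x invisible i =
    Equivalence.to T-≡ (All.lookup (all⁺ (λ j → adj (c j) x) (allFin k) allAdjacent) (∈-allFin i))
    where
    allAdjacent : T (all (λ j → adj (c j) x) (allFin k))
    allAdjacent = Equivalence.from T-≡ (not-injective invisible)

  CommonNeighbour : V G → V G → V G → Set
  CommonNeighbour x y w = Adj G x w × Adj G y w

  commonNeighbour : V G → V G → Maybe (V G)
  commonNeighbour x y with any? (λ w → Adj? x w ×-dec Adj? y w)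
  ... | yes (w , _) = just w
  ... | no _        = nothing

  commonNeighbour-unique : ¬ HasFourCycle G → ∀ {x y w w′} → x ≢ y →
    CommonNeighbour x y w → CommonNeighbour x y w′ → w ≡ w′
  commonNeighbour-unique noC4 {w = w} {w′} x≢y (xw , yw) (xw′ , yw′) with w ≟ w′
  ... | yes w≡w′ = w≡w′
  ... | no  w≢w′ = ⊥-elim (noC4 (_ , w , _ , w′ , x≢y , w≢w′ , xw , Adj-sym yw , yw′ , Adj-sym xw′))

  commonNeighbour-complete : ¬ HasFourCycle G → ∀ {x y w} → x ≢ y →
    CommonNeighbour x y w → commonNeighbour x y ≡ just w
  commonNeighbour-complete noC4 {x} {y} x≢y common
    with any? (λ w → Adj? x w ×-dec Adj? y w)
  ... | yes (_ , common′) = cong just (commonNeighbour-unique noC4 x≢y common′ common)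
  ... | no ¬common        = ⊥-elim (¬common (_ , common))

  escort : (e l l′ : V G) → V G
  escort e l l′ with l′ ≟ e
  ... | yes _ = l
  ... | no  _ = e

  escort-move : ∀ e {l l′} → Move G l l′ → Move G e (escort e l l′)
  escort-move e {l} {l′} l→l′ with l′ ≟ e
  ... | yes refl = Move-sym l→l′
  ... | no  _    = inj₁ refl

  escort-apart : ∀ {e l} l′ → e ≢ l → escort e l l′ ≢ l′
  escort-apart {e} {l} l′ e≢l with l′ ≟ e
  ... | yes l′≡e = λ l≡l′ → e≢l (sym (trans l≡l′ l′≡e))
  ... | no  l′≢e = λ e≡l′ → l′≢e (sym e≡l′)

  avoid : ∀ {u v : V G} → u ≢ v → ∀ w → ∃[ x ] x ≢ w
  avoid {u} {v} u≢v w with u ≟ w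
  ... | yes u≡w = v , λ v≡w → u≢v (trans u≡w (sym v≡w))
  ... | no  u≢w = u , u≢w

  noCopsLose : (vis : Visibility G) → V G → ¬ CopsWin G vis 0
  noCopsLose vis u (σ , wins) with wins (λ _ → u) (λ _ → inj₁ refl)
  ... | _ , inj₁ (() , _)
  ... | _ , inj₂ (() , _)

  -- Cop 0 of the new strategy escorts cop 1, and cops 1 … m+1 play σ.
  module Escorted (noC4 : ¬ HasFourCycle G) {m : ℕ} (σ : CopStrategy G (suc m))
    (e₀ : V G) (e₀≢l₀ : e₀ ≢ CopStrategy.start σ zero) where

    private
      module σ = CopStrategy σ
      K : ℕ
      K = suc (suc m)

    Apart : Config G K → Set
    Apart c = c zero ≢ c (suc zero)

    observe : Config G K → V G → Obs G
    observe c x = if hyperopicVis G c x then just x else nothing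

    decode : Config G K → Obs G → Obs G
    decode c (just x) = just x
    decode c nothing  = commonNeighbour (c zero) (c (suc zero))

    decode-observe : ∀ c x → Apart c → decode c (observe c x) ≡ just x
    decode-observe c x apart with hyperopicVis G c x in invisible
    ... | true  = refl
    ... | false = commonNeighbour-complete noC4 apart
                    (adjacent zero , adjacent (suc zero))
      where
      adjacent : ∀ i → Adj G (c i) x
      adjacent = invisible⇒adjacentToAll c x invisible

    step : (c : Config G K) → List (Obs G) → Σ (Config G K) (CopStep G c)
    step c h with σ.move (tail c) h
    ... | c′ , moves = (escort (c zero) (c (suc zero)) (c′ zero) Vector.∷ c′)
                     , λ { zero → escort-move (c zero) (moves zero) ; (suc i) → moves i }

    step-apart : ∀ c h → Apart c → Apart (proj₁ (step c h))
    step-apart c h = escort-apart (proj₁ (σ.move (tail c) h) zero)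

    start : Config G K
    start = e₀ Vector.∷ σ.start

    advance : Config G K × List (Obs G) → Obs G → Obs G → Config G K × List (Obs G)
    advance (c , h) o₁ o₀ = c′ , decode c′ o₁ ∷ decode c′ o₀ ∷ h
      where
      c′ : Config G K
      c′ = proj₁ (step c h)

    -- Recomputes the cops' positions and the decoded history, i.e. the
    -- history σ would have seen in the classical game.
    replay : List (Obs G) → Config G K × List (Obs G)
    replay []            = start , []
    replay (o ∷ [])      = start , decode start o ∷ []
    replay (o₁ ∷ o₀ ∷ h) = advance (replay h) o₁ o₀

    strategy : CopStrategy G K
    strategy = record { start = start ; move = λ c h → step c (proj₂ (replay h)) }

    advance-observed : ∀ c {h h′} → h′ ≡ h → Apart c → ∀ x₁ x₀ →
      let c′ = proj₁ (step c h′) in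
      advance (c , h) (observe c′ x₁) (observe c′ x₀) ≡ (c′ , just x₁ ∷ just x₀ ∷ h)
    advance-observed c {h} refl apart x₁ x₀ =
      cong₂ (λ o₁ o₀ → (_ , o₁ ∷ o₀ ∷ h))
        (decode-observe _ x₁ (step-apart c h apart))
        (decode-observe _ x₀ (step-apart c h apart))

    module _ (r : ℕ → V G) where
      private
        module H = Play G (hyperopicVis G) strategy r
        module C = Play G (classicalVis G) σ r

      cops-apart : ∀ t → Apart (H.cops t)
      cops-apart zero    = e₀≢l₀
      cops-apart (suc t) = step-apart (H.cops t) _ (cops-apart t)

      replay-tracks : ∀ t → replay (proj₂ (H.state t)) ≡ (H.cops t , proj₂ (C.state t))
      replay-tracks zero    = cong (λ o → start , o ∷ []) (decode-observe start (r zero) (cops-apart zero))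
      replay-tracks (suc t) = trans
        (cong (λ q → advance q (observe c′ (r (suc t))) (observe c′ (r t))) (replay-tracks t))
        (advance-observed (H.cops t) (cong proj₂ (replay-tracks t)) (cops-apart t) (r (suc t)) (r t))
        where
        c′ : Config G K
        c′ = H.cops (suc t)

      shadows : ∀ t → tail (H.cops t) ≡ C.cops t
      shadows zero    = refl
      shadows (suc t) = cong₂ (λ c h → proj₁ (σ.move c h)) (shadows t) (cong proj₂ (replay-tracks t))

      capture-preserved : ∀ {t} → Play.CaughtAt G (classicalVis G) σ r t → H.CaughtAt t
      capture-preserved {t} (inj₁ (i , caught)) = inj₁ (suc i , trans (cong-app (shadows t) i) caught)
      capture-preserved {t} (inj₂ (i , caught)) = inj₂ (suc i , trans (cong-app (shadows (suc t)) i) caught)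

  classicalWin⇒hyperopicWin : ¬ HasFourCycle G → ∀ {u v : V G} → u ≢ v → ∀ c →
    CopsWin G (classicalVis G) c → CopsWin G (hyperopicVis G) (suc c)
  classicalWin⇒hyperopicWin noC4 {u} u≢v zero win = ⊥-elim (noCopsLose (classicalVis G) u win)
  classicalWin⇒hyperopicWin noC4 u≢v (suc m) (σ , wins) =
    strategy , λ r play → let t , caught = wins r play in t , capture-preserved r caught
    where open Escorted noC4 σ _ (proj₂ (avoid u≢v (CopStrategy.start σ zero)))

mainTheorem8 : (G : Graph) → Connected G → DiamAtLeast3 G →
    (c : ℕ) → IsCopNumber G c → IsHyperopicCopNumber G (c + 2) →
    HasTriangle G ⊎ HasFourCycle G
mainTheorem8 G _ (u , v , far) c (win , _) (_ , minimal) with hasFourCycle? G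
... | yes c4   = inj₂ c4
... | no  noC4 = ⊥-elim (minimal (suc c) c+1<c+2
                   (classicalWin⇒hyperopicWin G noC4 u≢v c win))
  where
  u≢v : u ≢ v
  u≢v refl with far 0 here
  ... | ()
  c+1<c+2 : suc c < c + 2
  c+1<c+2 = subst (suc c <_) (+-comm 2 c) (n<1+n (suc c))
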